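{- Let $H$ be a clique-grid graph with representation $f:V(H)\to[2k]\times[2k]$, and suppose $H$ contains a cycle on exactly $k$ vertices. Then $H$ contains a cycle $C$ on exactly $k$ vertices such that for any two distinct cells $(i,j)$ and $(i',j')$, the number of edges of $C$ with one endpoint in $f^{ -1}(i,j)$ and the other in $f^{ -1}(i',j')$ is at most $5$.
   Context: A graph $H$ is a clique-grid graph with representation $f:V(H)\to[t]\times[t']$ if (1) for every cell $(i,j)\in[t]\times[t']$, $f^{ -1}(i,j)$ is a clique, and (2) for every edge $\{u,v\}$ with $f(u)=(i,j)$, $f(v)=(i',j')$, $|i-i'|\le 2$ and $|j-j'|\le 2$. -}

module Defs where

open import Data.Nat using (ℕ; zero; suc; _≤_; _*_; ∣_-_∣)
open import Data.Nat.DivMod using (_mod_)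
open import Data.Fin using (Fin; toℕ) renaming (_≟_ to _≟ᶠ_)
open import Data.Product using (_×_; _,_; proj₁; proj₂)
open import Data.Product.Properties using (≡-dec)
open import Data.Sum using (_⊎_)
open import Data.List using (length; filter)
open import Data.List.Base using (allFin)
open import Relation.Nullary using (¬_; Dec)
open import Relation.Nullary.Decidable using (_×-dec_; _⊎-dec_)
open import Relation.Binary.PropositionalEquality using (_≡_)
open import Function.Definitions using (Injective)

record SimpleGraph (n : ℕ) : Set₁ where
  field
    Adj     : Fin n → Fin n → Set
    sym     : ∀ {u v} → Adj u v → Adj v u
    irrefl  : ∀ {u} → ¬ Adj u u

open SimpleGraph public

-- Cells of the grid [t] × [t'] (coordinates 0-based via Fin).
Cell : ℕ → ℕ → Set
Cell t t' = Fin t × Fin t'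

_≟ᶜ_ : ∀ {t t'} (p q : Cell t t') → Dec (p ≡ q)
_≟ᶜ_ = ≡-dec _≟ᶠ_ _≟ᶠ_

record IsCliqueGrid {n t t' : ℕ} (H : SimpleGraph n) (f : Fin n → Cell t t') : Set where
  field
    cellClique : ∀ u v → f u ≡ f v → ¬ u ≡ v → Adj H u v
    edgeLocal  : ∀ u v → Adj H u v →
                 (∣ toℕ (proj₁ (f u)) - toℕ (proj₁ (f v)) ∣ ≤ 2) ×
                 (∣ toℕ (proj₂ (f u)) - toℕ (proj₂ (f v)) ∣ ≤ 2)

cnext : ∀ {k} → Fin k → Fin k
cnext {suc k} i = suc (toℕ i) mod suc k

record IsCycle {n : ℕ} (H : SimpleGraph n) (k : ℕ) (c : Fin k → Fin n) : Set where
  field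
    length≥3 : 3 ≤ k
    distinct : Injective _≡_ _≡_ c
    adjacent : ∀ i → Adj H (c i) (c (cnext i))

edgesBetween : ∀ {n t t' k} (f : Fin n → Cell t t') (c : Fin k → Fin n)
               (p q : Cell t t') → ℕ
edgesBetween {k = k} f c p q =
  length (filter (λ i → ((f (c i) ≟ᶜ p) ×-dec (f (c (cnext i)) ≟ᶜ q))
                        ⊎-dec ((f (c i) ≟ᶜ q) ×-dec (f (c (cnext i)) ≟ᶜ p)))
                 (allFin k))

module Submission where

-- Proof idea (2-opt).  Call a cycle edge crossing if its endpoints lie in different
-- cells, and let the potential of a cycle be its number of crossing edges.
-- Call edges i < j of a cycle c parallel if both are crossing and lead from
-- the same cell p to the same cell q.  Reversing the segment c(i+1) … c(j)
-- then yields a cycle on the same vertices whose edges are those of c, except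
-- that the two crossing edges i and j are replaced by the edges
-- c(i) c(j) and c(i+1) c(j+1), which lie inside the cells p and q (cliques).
-- The potential drops, so by well-founded induction some cycle on k vertices
-- has no parallel pair.  In such a cycle each of the two directions p → q and
-- q → p is used by at most one edge, so at most 2 ≤ 5 edges join two cells.

open import Defs hiding (sym)
open import Data.Nat using (ℕ; zero; suc; _≤_; _<_; _+_; _∸_; _*_; _%_; z≤n; s≤s; z<s; _<?_)
open import Data.Nat.Properties
open import Data.Nat.DivMod using (m<n⇒m%n≡m; n%n≡0)
open import Data.Nat.Induction using (<-wellFounded)
open import Data.Fin using (Fin; zero; suc; toℕ; fromℕ<)
open import Data.Fin.Properties using (toℕ-injective; toℕ<n; toℕ-fromℕ<; any?)
open import Data.Fin.Permutation using (Permutation′; permutation)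
open import Algebra.Properties.CommutativeMonoid.Sum +-0-commutativeMonoid using (sum; sum-permute)
open import Data.List using ([]; _∷_; length; filter; allFin)
open import Data.List.Relation.Unary.All using (All; []; _∷_)
open import Data.List.Relation.Unary.All.Properties using (all-filter)
open import Data.List.Relation.Unary.Unique.Propositional using (Unique; []; _∷_)
open import Data.List.Relation.Unary.Unique.Propositional.Properties using (allFin⁺; filter⁺)
open import Data.Product using (Σ; _×_; _,_; proj₂; swap; uncurry)
open import Data.Sum using (_⊎_; inj₁; inj₂; [_,_])
open import Data.Empty using (⊥-elim)
open import Function using (_∘_)
open import Induction.WellFounded using (Acc; acc)
open import Relation.Unary using (Decidable)
open import Relation.Nullary using (¬_; Dec; yes; no; contradiction)
open import Relation.Nullary.Decidable using (_×-dec_; _⊎-dec_; ¬?)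
open import Relation.Binary using (tri<; tri≈; tri>)
open import Relation.Binary.PropositionalEquality
  using (_≡_; refl; sym; trans; cong; cong₂; subst; module ≡-Reasoning)

module _ {A : Set} {P Q : A → Set} (P? : Decidable P) (Q? : Decidable Q) where

  count-⊎ : ∀ xs → length (filter (λ x → P? x ⊎-dec Q? x) xs)
                     ≤ length (filter P? xs) + length (filter Q? xs)
  count-⊎ [] = z≤n
  count-⊎ (x ∷ xs) with P? x | Q? x
  ... | yes _ | yes _ = s≤s (≤-trans (count-⊎ xs) (+-monoʳ-≤ _ (n≤1+n _)))
  ... | yes _ | no  _ = s≤s (count-⊎ xs)
  ... | no  _ | yes _ = ≤-trans (s≤s (count-⊎ xs)) (≤-reflexive (sym (+-suc _ _)))
  ... | no  _ | no  _ = count-⊎ xs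

module _ {A : Set} {P : A → Set} (P? : Decidable P)
         (at-most-one : ∀ {x y} → P x → P y → x ≡ y) where

  unique-length≤1 : ∀ {ys} → Unique ys → All P ys → length ys ≤ 1
  unique-length≤1 []                  _                = z≤n
  unique-length≤1 (_ ∷ [])            _                = s≤s z≤n
  unique-length≤1 ((x≢y ∷ _) ∷ _ ∷ _) (px ∷ py ∷ _)    = ⊥-elim (x≢y (at-most-one px py))

  count-unique : ∀ {xs} → Unique xs → length (filter P? xs) ≤ 1
  count-unique {xs} u = unique-length≤1 (filter⁺ P? u) (all-filter P? xs)

sum-mono-≤ : ∀ {m} {g h : Fin m → ℕ} → (∀ x → g x ≤ h x) → sum g ≤ sum h
sum-mono-≤ {zero}  _  = z≤n
sum-mono-≤ {suc m} le = +-mono-≤ (le zero) (sum-mono-≤ (le ∘ suc))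

sum-mono-< : ∀ {m} {g h : Fin m → ℕ} → (∀ x → g x ≤ h x) →
             ∀ x₀ → g x₀ < h x₀ → sum g < sum h
sum-mono-< le zero    lt = +-mono-<-≤ lt (sum-mono-≤ (le ∘ suc))
sum-mono-< le (suc x) lt = +-mono-≤-< (le zero) (sum-mono-< (le ∘ suc) x lt)

mirror : ℕ → ℕ → ℕ → ℕ
mirror l r m with l <? m | m <? r
... | yes _ | yes _ = (l + r) ∸ m
... | _     | _     = m

Outside : ℕ → ℕ → ℕ → Set
Outside l r m = m ≤ l ⊎ r ≤ m

mirror-inside : ∀ {l r m} → l < m → m < r → mirror l r m ≡ (l + r) ∸ m
mirror-inside {l} {r} {m} l<m m<r with l <? m | m <? r
... | yes _   | yes _   = refl
... | no l≮m  | _       = contradiction l<m l≮m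
... | yes _   | no m≮r  = contradiction m<r m≮r

mirror-outside : ∀ {l r m} → Outside l r m → mirror l r m ≡ m
mirror-outside {l} {r} {m} out with l <? m | m <? r
... | yes l<m | yes m<r = contradiction out [ (λ m≤l → <⇒≱ l<m m≤l) , (λ r≤m → <⇒≱ m<r r≤m) ]
... | yes _   | no  _   = refl
... | no  _   | _       = refl

reflected-inside : ∀ {l r m} → l < m → m < r → l < (l + r) ∸ m × (l + r) ∸ m < r
reflected-inside {l} {r} {m} l<m m<r =
    subst (_< (l + r) ∸ m) (m+n∸n≡m l r) (∸-monoʳ-< m<r (m≤n+m r l))
  , subst ((l + r) ∸ m <_) (m+n∸m≡n l r) (∸-monoʳ-< l<m (≤-trans (<⇒≤ m<r) (m≤n+m r l)))

mirror-cases : ∀ l r m → (l < m × m < r) ⊎ Outside l r m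
mirror-cases l r m with l <? m | m <? r
... | yes l<m | yes m<r = inj₁ (l<m , m<r)
... | yes _   | no  m≮r = inj₂ (inj₂ (≮⇒≥ m≮r))
... | no  l≮m | _       = inj₂ (inj₁ (≮⇒≥ l≮m))

mirror-involutive : ∀ l r m → mirror l r (mirror l r m) ≡ m
mirror-involutive l r m with mirror-cases l r m
... | inj₂ out = trans (cong (mirror l r) (mirror-outside out)) (mirror-outside out)
... | inj₁ (l<m , m<r) = begin
  mirror l r (mirror l r m)   ≡⟨ cong (mirror l r) (mirror-inside l<m m<r) ⟩
  mirror l r ((l + r) ∸ m)    ≡⟨ uncurry mirror-inside (reflected-inside l<m m<r) ⟩
  (l + r) ∸ ((l + r) ∸ m)     ≡⟨ m∸[m∸n]≡n (≤-trans (<⇒≤ m<r) (m≤n+m r l)) ⟩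
  m                           ∎
  where open ≡-Reasoning

mirror-< : ∀ {l r k m} → r ≤ k → m < k → mirror l r m < k
mirror-< {l} {r} {k} {m} r≤k m<k with mirror-cases l r m
... | inj₁ (l<m , m<r) = subst (_< k) (sym (mirror-inside l<m m<r))
                               (<-≤-trans (proj₂ (reflected-inside l<m m<r)) r≤k)
... | inj₂ out = subst (_< k) (sym (mirror-outside out)) m<k

module _ {k : ℕ} (l r : ℕ) (r≤k : r ≤ k) where

  mirrorᶠ : Fin k → Fin k
  mirrorᶠ x = fromℕ< (mirror-< {l} r≤k (toℕ<n x))

  toℕ-mirrorᶠ : ∀ x → toℕ (mirrorᶠ x) ≡ mirror l r (toℕ x)
  toℕ-mirrorᶠ x = toℕ-fromℕ< _

  mirrorᶠ-outside : ∀ x → Outside l r (toℕ x) → mirrorᶠ x ≡ x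
  mirrorᶠ-outside x out = toℕ-injective (trans (toℕ-mirrorᶠ x) (mirror-outside out))

  mirrorᶠ-involutive : ∀ x → mirrorᶠ (mirrorᶠ x) ≡ x
  mirrorᶠ-involutive x = toℕ-injective (begin
    toℕ (mirrorᶠ (mirrorᶠ x))    ≡⟨ toℕ-mirrorᶠ (mirrorᶠ x) ⟩
    mirror l r (toℕ (mirrorᶠ x)) ≡⟨ cong (mirror l r) (toℕ-mirrorᶠ x) ⟩
    mirror l r (mirror l r (toℕ x)) ≡⟨ mirror-involutive l r (toℕ x) ⟩
    toℕ x                        ∎)
    where open ≡-Reasoning

  mirror-permutation : Permutation′ k
  mirror-permutation = permutation mirrorᶠ mirrorᶠ mirrorᶠ-involutive mirrorᶠ-involutive

toℕ-cnext : ∀ {k} (x : Fin k) → suc (toℕ x) < k → toℕ (cnext x) ≡ suc (toℕ x)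
toℕ-cnext {suc k} x lt = trans (toℕ-fromℕ< _) (m<n⇒m%n≡m lt)

toℕ-cnext-last : ∀ {k} (x : Fin k) → suc (toℕ x) ≡ k → toℕ (cnext x) ≡ 0
toℕ-cnext-last {suc k} x eq = trans (toℕ-fromℕ< _) (trans (cong (_% suc k) eq) (n%n≡0 (suc k)))

cnext-cases : ∀ {k} (x : Fin k) →
              toℕ (cnext x) ≡ suc (toℕ x) ⊎ (toℕ (cnext x) ≡ 0 × suc (toℕ x) ≡ k)
cnext-cases x with m≤n⇒m<n∨m≡n (toℕ<n x)
... | inj₁ lt = inj₁ (toℕ-cnext x lt)
... | inj₂ eq = inj₂ (toℕ-cnext-last x eq , eq)

cnext-injective : ∀ {k} {x y : Fin k} → cnext x ≡ cnext y → x ≡ y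
cnext-injective {x = x} {y} eq with cnext-cases x | cnext-cases y
... | inj₁ ex | inj₁ ey = toℕ-injective (suc-injective (trans (sym ex) (trans (cong toℕ eq) ey)))
... | inj₁ ex | inj₂ (ey , _) = contradiction (trans (sym ex) (trans (cong toℕ eq) ey)) 1+n≢0
... | inj₂ (ex , _) | inj₁ ey = contradiction (trans (sym ey) (trans (cong toℕ (sym eq)) ex)) 1+n≢0
... | inj₂ (_ , lx) | inj₂ (_ , ly) = toℕ-injective (suc-injective (trans lx (sym ly)))

-- A reflection of (l, r) that fixes toℕ x + 1 also fixes the successor of x
-- (0 is always fixed).
cnext-outside : ∀ {k l r} (x : Fin k) → Outside l r (suc (toℕ x)) → Outside l r (toℕ (cnext x))
cnext-outside x out with cnext-cases x
... | inj₁ ex       = subst (Outside _ _) (sym ex) out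
... | inj₂ (ex , _) = inj₁ (subst (_≤ _) (sym ex) z≤n)

module CliqueCells {n t t' : ℕ} (H : SimpleGraph n) (f : Fin n → Cell t t')
                   (cellClique : ∀ u v → f u ≡ f v → ¬ u ≡ v → Adj H u v) where

  crossing : Fin n → Fin n → ℕ
  crossing u v with f u ≟ᶜ f v
  ... | yes _ = 0
  ... | no  _ = 1

  crossing-same : ∀ {u v} → f u ≡ f v → crossing u v ≡ 0
  crossing-same {u} {v} eq with f u ≟ᶜ f v
  ... | yes _  = refl
  ... | no neq = contradiction eq neq

  crossing-distinct : ∀ {u v} → ¬ f u ≡ f v → crossing u v ≡ 1
  crossing-distinct {u} {v} neq with f u ≟ᶜ f v
  ... | yes eq = contradiction eq neq
  ... | no  _  = refl

  crossing-sym : ∀ u v → crossing u v ≡ crossing v u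
  crossing-sym u v with f u ≟ᶜ f v
  ... | yes eq  = sym (crossing-same (sym eq))
  ... | no  neq = sym (crossing-distinct (neq ∘ sym))

  edge : ∀ {k} → (Fin k → Fin n) → Fin k → Fin n × Fin n
  edge c x = c x , c (cnext x)

  _≈ᵉ_ : Fin n × Fin n → Fin n × Fin n → Set
  e ≈ᵉ e' = e ≡ e' ⊎ e ≡ swap e'

  adjacent-≈ᵉ : ∀ {e e'} → e ≈ᵉ e' → uncurry (Adj H) e' → uncurry (Adj H) e
  adjacent-≈ᵉ (inj₁ refl) a = a
  adjacent-≈ᵉ (inj₂ refl) a = SimpleGraph.sym H a

  crossing-≈ᵉ : ∀ {e e'} → e ≈ᵉ e' → uncurry crossing e ≡ uncurry crossing e'
  crossing-≈ᵉ {e' = u , v} (inj₁ refl) = refl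
  crossing-≈ᵉ {e' = u , v} (inj₂ refl) = crossing-sym v u

  crossingAt : ∀ {k} → (Fin k → Fin n) → Fin k → ℕ
  crossingAt c = uncurry crossing ∘ edge c

  potential : ∀ {k} → (Fin k → Fin n) → ℕ
  potential c = sum (crossingAt c)

  Parallel : ∀ {k} → (Fin k → Fin n) → Fin k → Fin k → Set
  Parallel c i j = toℕ i < toℕ j × f (c i) ≡ f (c j) × f (c (cnext i)) ≡ f (c (cnext j))
                   × ¬ f (c i) ≡ f (c (cnext i))

  parallel? : ∀ {k} (c : Fin k → Fin n) i j → Dec (Parallel c i j)
  parallel? c i j = toℕ i <? toℕ j ×-dec f (c i) ≟ᶜ f (c j)
                    ×-dec f (c (cnext i)) ≟ᶜ f (c (cnext j)) ×-dec ¬? (f (c i) ≟ᶜ f (c (cnext i)))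

  module TwoOpt {k} (c : Fin k → Fin n) (cycle : IsCycle H k c) (i j : Fin k)
                (i<j : toℕ i < toℕ j) (sameTail : f (c i) ≡ f (c j))
                (sameHead : f (c (cnext i)) ≡ f (c (cnext j)))
                (crosses : ¬ f (c i) ≡ f (c (cnext i))) where

    open IsCycle cycle

    I J : ℕ
    I = toℕ i
    J = toℕ j

    -- σ reverses the vertex segment (I, J + 1); τ reverses the edge segment (I, J).
    σ τ : Fin k → Fin k
    σ = mirrorᶠ I (suc J) (toℕ<n j)
    τ = mirrorᶠ I J (<⇒≤ (toℕ<n j))

    c' : Fin k → Fin n
    c' = c ∘ σ

    σ-outside : ∀ x → Outside I (suc J) (toℕ x) → σ x ≡ x
    σ-outside = mirrorᶠ-outside I (suc J) (toℕ<n j)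

    τ-outside : ∀ x → Outside I J (toℕ x) → τ x ≡ x
    τ-outside = mirrorᶠ-outside I J (<⇒≤ (toℕ<n j))

    toℕ-σ : ∀ x → toℕ (σ x) ≡ mirror I (suc J) (toℕ x)
    toℕ-σ = toℕ-mirrorᶠ I (suc J) (toℕ<n j)

    toℕ-τ : ∀ x → toℕ (τ x) ≡ mirror I J (toℕ x)
    toℕ-τ = toℕ-mirrorᶠ I J (<⇒≤ (toℕ<n j))

    c-at : ∀ {x y} → toℕ x ≡ toℕ y → c x ≡ c y
    c-at = cong c ∘ toℕ-injective

    edge-outside : ∀ {x} → toℕ x < I ⊎ J < toℕ x → edge c' x ≡ edge c (τ x)
    edge-outside {x} out = begin
      (c (σ x) , c (σ (cnext x))) ≡⟨ cong₂ _,_ (cong c (σ-outside x outσ))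
                                              (cong c (σ-outside (cnext x) (cnext-outside x outσ⁺))) ⟩
      edge c x                    ≡⟨ cong (edge c) (sym (τ-outside x outτ)) ⟩
      edge c (τ x)                ∎
      where
        open ≡-Reasoning
        outσ : Outside I (suc J) (toℕ x)
        outσ = [ inj₁ ∘ <⇒≤ , inj₂ ] out
        outσ⁺ : Outside I (suc J) (suc (toℕ x))
        outσ⁺ = [ inj₁ , inj₂ ∘ m≤n⇒m≤1+n ] out
        outτ : Outside I J (toℕ x)
        outτ = [ inj₁ ∘ <⇒≤ , inj₂ ∘ <⇒≤ ] out

    suc-I<k : suc I < k
    suc-I<k = ≤-<-trans i<j (toℕ<n j)

    edge-at-i : edge c' i ≡ (c i , c j)
    edge-at-i = cong₂ _,_ (cong c (σ-outside i (inj₁ ≤-refl))) (c-at (begin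
      toℕ (σ (cnext i))              ≡⟨ toℕ-σ (cnext i) ⟩
      mirror I (suc J) (toℕ (cnext i)) ≡⟨ cong (mirror I (suc J)) (toℕ-cnext i suc-I<k) ⟩
      mirror I (suc J) (suc I)       ≡⟨ mirror-inside (n<1+n I) (s≤s i<j) ⟩
      (I + suc J) ∸ suc I            ≡⟨ cong (_∸ suc I) (+-suc I J) ⟩
      (I + J) ∸ I                    ≡⟨ m+n∸m≡n I J ⟩
      J                              ∎))
      where open ≡-Reasoning

    edge-at-j : edge c' j ≡ (c (cnext i) , c (cnext j))
    edge-at-j = cong₂ _,_ (c-at (begin
      toℕ (σ j)              ≡⟨ toℕ-σ j ⟩
      mirror I (suc J) J     ≡⟨ mirror-inside i<j (n<1+n J) ⟩
      (I + suc J) ∸ J        ≡⟨ cong (_∸ J) (+-suc I J) ⟩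
      (suc I + J) ∸ J        ≡⟨ m+n∸n≡m (suc I) J ⟩
      suc I                  ≡⟨ toℕ-cnext i suc-I<k ⟨
      toℕ (cnext i)          ∎))
      (cong c (σ-outside (cnext j) (cnext-outside j (inj₂ ≤-refl))))
      where open ≡-Reasoning

    edge-inside : ∀ {x} → I < toℕ x → toℕ x < J → edge c' x ≡ swap (edge c (τ x))
    edge-inside {x} I<x x<J = cong₂ _,_ (c-at σx≡) (c-at σx⁺≡)
      where
        open ≡-Reasoning
        X = toℕ x
        T = (I + J) ∸ X

        τx≡T : toℕ (τ x) ≡ T
        τx≡T = trans (toℕ-τ x) (mirror-inside I<x x<J)

        τx<J : toℕ (τ x) < J
        τx<J = subst (_< J) (sym τx≡T) (proj₂ (reflected-inside I<x x<J))

        σx≡ : toℕ (σ x) ≡ toℕ (cnext (τ x))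
        σx≡ = begin
          toℕ (σ x)             ≡⟨ toℕ-σ x ⟩
          mirror I (suc J) X    ≡⟨ mirror-inside I<x (m≤n⇒m≤1+n x<J) ⟩
          (I + suc J) ∸ X       ≡⟨ cong (_∸ X) (+-suc I J) ⟩
          suc (I + J) ∸ X       ≡⟨ +-∸-assoc 1 (≤-trans (<⇒≤ x<J) (m≤n+m J I)) ⟩
          suc T                 ≡⟨ cong suc τx≡T ⟨
          suc (toℕ (τ x))       ≡⟨ toℕ-cnext (τ x) (≤-<-trans τx<J (toℕ<n j)) ⟨
          toℕ (cnext (τ x))     ∎

        σx⁺≡ : toℕ (σ (cnext x)) ≡ toℕ (τ x)
        σx⁺≡ = begin
          toℕ (σ (cnext x))                ≡⟨ toℕ-σ (cnext x) ⟩
          mirror I (suc J) (toℕ (cnext x)) ≡⟨ cong (mirror I (suc J)) (toℕ-cnext x (≤-<-trans x<J (toℕ<n j))) ⟩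
          mirror I (suc J) (suc X)         ≡⟨ mirror-inside (m≤n⇒m≤1+n I<x) (s≤s x<J) ⟩
          (I + suc J) ∸ suc X              ≡⟨ cong (_∸ suc X) (+-suc I J) ⟩
          T                                ≡⟨ τx≡T ⟨
          toℕ (τ x)                        ∎

    data NewEdge (x : Fin k) : Set where
      transported : edge c' x ≈ᵉ edge c (τ x) → NewEdge x
      at-i        : x ≡ i → NewEdge x
      at-j        : x ≡ j → NewEdge x

    classify : ∀ x → NewEdge x
    classify x with <-cmp (toℕ x) I | <-cmp (toℕ x) J
    ... | tri< x<I _ _ | _            = transported (inj₁ (edge-outside (inj₁ x<I)))
    ... | tri≈ _ x≡I _ | _            = at-i (toℕ-injective x≡I)
    ... | tri> _ _ I<x | tri< x<J _ _ = transported (inj₂ (edge-inside I<x x<J))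
    ... | tri> _ _ _   | tri≈ _ x≡J _ = at-j (toℕ-injective x≡J)
    ... | tri> _ _ _   | tri> _ _ J<x = transported (inj₁ (edge-outside (inj₂ J<x)))

    -- c' is again a cycle on k vertices: σ is a bijection, the new edges lie
    -- inside cells (cliques), and the other edges are edges of c.
    cycle' : IsCycle H k c'
    cycle' = record
      { length≥3 = length≥3
      ; distinct = λ {x} {y} eq → begin
          x         ≡⟨ mirrorᶠ-involutive I (suc J) (toℕ<n j) x ⟨
          σ (σ x)   ≡⟨ cong σ (distinct eq) ⟩
          σ (σ y)   ≡⟨ mirrorᶠ-involutive I (suc J) (toℕ<n j) y ⟩
          y         ∎
      ; adjacent = adjacent'
      }
      where
        open ≡-Reasoning
        adjacent' : ∀ x → Adj H (c' x) (c' (cnext x))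
        adjacent' x with classify x
        ... | transported e = adjacent-≈ᵉ e (adjacent (τ x))
        ... | at-i refl = adjacent-≈ᵉ (inj₁ edge-at-i)
                            (cellClique _ _ sameTail (<⇒≢ i<j ∘ cong toℕ ∘ distinct))
        ... | at-j refl = adjacent-≈ᵉ (inj₁ edge-at-j)
                            (cellClique _ _ sameHead (<⇒≢ i<j ∘ cong toℕ ∘ cnext-injective ∘ distinct))

    new-edge-i : crossingAt c' i ≡ 0
    new-edge-i = trans (cong (uncurry crossing) edge-at-i) (crossing-same sameTail)

    new-edge-j : crossingAt c' j ≡ 0
    new-edge-j = trans (cong (uncurry crossing) edge-at-j) (crossing-same sameHead)

    crossing-bound : ∀ x → crossingAt c' x ≤ crossingAt c (τ x)
    crossing-bound x with classify x
    ... | transported e = ≤-reflexive (crossing-≈ᵉ e)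
    ... | at-i refl     = subst (_≤ crossingAt c (τ i)) (sym new-edge-i) z≤n
    ... | at-j refl     = subst (_≤ crossingAt c (τ j)) (sym new-edge-j) z≤n

    crossing-drop : crossingAt c' i < crossingAt c (τ i)
    crossing-drop = begin-strict
      crossingAt c' i    ≡⟨ new-edge-i ⟩
      0                  <⟨ z<s ⟩
      1                  ≡⟨ crossing-distinct crosses ⟨
      crossingAt c i     ≡⟨ cong (crossingAt c) (τ-outside i (inj₁ ≤-refl)) ⟨
      crossingAt c (τ i) ∎
      where open ≤-Reasoning

    -- Since τ is a permutation of the edge indices, the potential drops.
    potential-decreases : potential c' < potential c
    potential-decreases = begin-strict
      potential c'                 <⟨ sum-mono-< crossing-bound i crossing-drop ⟩
      sum (crossingAt c ∘ τ)       ≡⟨ sum-permute (crossingAt c) (mirror-permutation I J (<⇒≤ (toℕ<n j))) ⟨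
      potential c                  ∎
      where open ≤-Reasoning

  two-opt : ∀ {k} {c : Fin k → Fin n} → IsCycle H k c → ∀ {i j} → Parallel c i j →
            Σ (Fin k → Fin n) λ c' → IsCycle H k c' × potential c' < potential c
  two-opt cycle (i<j , sameTail , sameHead , crosses) =
    c' , cycle' , potential-decreases
    where open TwoOpt _ cycle _ _ i<j sameTail sameHead crosses

  parallel-free : ∀ {k} {c : Fin k → Fin n} → IsCycle H k c → Acc _<_ (potential c) →
                  Σ (Fin k → Fin n) λ c' → IsCycle H k c' × (∀ i j → ¬ Parallel c' i j)
  parallel-free {c = c} cycle (acc smaller) with any? (λ i → any? (λ j → parallel? c i j))
  ... | no none = c , cycle , λ i j par → none (i , j , par)
  ... | yes (i , j , par) with two-opt cycle par
  ...   | c' , cycle' , dec = parallel-free cycle' (smaller dec)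

  module _ {k} {c : Fin k → Fin n} (noParallel : ∀ i j → ¬ Parallel c i j) where

    directed-unique : ∀ {p q} → ¬ p ≡ q → ∀ {x y} →
                      f (c x) ≡ p × f (c (cnext x)) ≡ q → f (c y) ≡ p × f (c (cnext y)) ≡ q →
                      x ≡ y
    directed-unique p≢q {x} {y} (px , qx) (py , qy) with <-cmp (toℕ x) (toℕ y)
    ... | tri< x<y _ _ = ⊥-elim (noParallel x y (x<y , trans px (sym py) , trans qx (sym qy) ,
                                                    λ e → p≢q (trans (sym px) (trans e qx))))
    ... | tri≈ _ x≡y _ = toℕ-injective x≡y
    ... | tri> _ _ y<x = ⊥-elim (noParallel y x (y<x , trans py (sym px) , trans qy (sym qx) ,
                                                    λ e → p≢q (trans (sym py) (trans e qy))))

    directed : (p q : Cell t t') → Decidable (λ x → f (c x) ≡ p × f (c (cnext x)) ≡ q)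
    directed p q x = (f (c x) ≟ᶜ p) ×-dec (f (c (cnext x)) ≟ᶜ q)

    edgesBetween-bound : ∀ p q → ¬ p ≡ q → edgesBetween f c p q ≤ 5
    edgesBetween-bound p q p≢q = begin
      edgesBetween f c p q
        ≤⟨ count-⊎ (directed p q) (directed q p) (allFin k) ⟩
      length (filter (directed p q) (allFin k)) + length (filter (directed q p) (allFin k))
        ≤⟨ +-mono-≤ (count-unique (directed p q) (directed-unique p≢q) (allFin⁺ k))
                    (count-unique (directed q p) (directed-unique (p≢q ∘ sym)) (allFin⁺ k)) ⟩
      2
        ≤⟨ s≤s (s≤s z≤n) ⟩
      5 ∎
      where open ≤-Reasoning

lemma30 : (k n : ℕ) (H : SimpleGraph n) (f : Fin n → Cell (2 * k) (2 * k)) →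
          IsCliqueGrid H f →
          Σ (Fin k → Fin n) (λ c → IsCycle H k c) →
          Σ (Fin k → Fin n) (λ C → IsCycle H k C ×
            ((p q : Cell (2 * k) (2 * k)) → ¬ p ≡ q → edgesBetween f C p q ≤ 5))
lemma30 k n H f grid (c , cycle) =
  let c' , cycle' , noParallel = parallel-free cycle (<-wellFounded (potential c))
  in  c' , cycle' , edgesBetween-bound noParallel
  where open CliqueCells H f (IsCliqueGrid.cellClique grid)
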